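{- Let $\mathbf{K}$ be an arbitrary class of $\mathcal{L}$-algebras. Then $\mathbb{P}_S(\mathbf{K})\subseteq\mathbb{S}_\forall\mathbb{P}(\mathbf{K})$; more precisely, if $f:\mathcal{A}\to\prod_{i\in I}\mathcal{B}_i$ witnesses that $\mathcal{A}$ is a subdirect product of algebras $\mathcal{B}_i\in\mathbf{K}$, then $f$ is a $\forall$-embedding.
   Context: $\mathcal{L}$ is an algebraic first-order language; atomic formulas are equations. $\mathbb{P}_S(\mathbf{K})$ is the class of subdirect products of members of $\mathbf{K}$ (embeddings into products whose compositions with all projections are surjective), and $\mathbb{S}_\forall\mathbb{P}(\mathbf{K})$ the class of $\forall$-subalgebras of direct products of members of $\mathbf{K}$. An embedding $f:\mathcal{A}\to\mathcal{B}$ is a $\forall$-embedding (and $\mathcal{A}$ is then regarded as a $\forall$-subalgebra) if for every atomic $\phi(\overline x,\overline y)$ and $\overline a$ in $A$, $\mathcal{A}\vDash\forall\overline x\phi(\overline x,\overline a)$ implies $\mathcal{B}\vDash\forall\overline x\phi(\overline x,f\overline a)$. -}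

module Defs where

open import Level using (Level; _⊔_; suc)
open import Data.Nat using (ℕ)
open import Data.Fin using (Fin)
open import Data.Sum using (_⊎_; [_,_])
open import Data.Product using (Σ; _×_; _,_)
open import Relation.Binary.Bundles using (Setoid)
open import Relation.Unary using (Pred)

record Signature : Set₁ where
  field
    Op    : Set
    arity : Op → ℕ

module _ (𝓛 : Signature) where
  open Signature 𝓛

  record Algebra (a ℓ : Level) : Set (suc (a ⊔ ℓ)) where
    field
      setoid : Setoid a ℓ
    open Setoid setoid public renaming (Carrier to ∣_∣)
    field
      ⟦_⟧  : (o : Op) → (Fin (arity o) → ∣_∣) → ∣_∣
      ⟦⟧-cong : (o : Op) {xs ys : Fin (arity o) → ∣_∣} →
                (∀ k → xs k ≈ ys k) → ⟦ o ⟧ xs ≈ ⟦ o ⟧ ys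

  data Term (V : Set) : Set where
    var : V → Term V
    op  : (o : Op) → (Fin (arity o) → Term V) → Term V

  eval : ∀ {a ℓ} (𝒜 : Algebra a ℓ) {V : Set} → Term V →
         (V → Algebra.∣_∣ 𝒜) → Algebra.∣_∣ 𝒜
  eval 𝒜 (var v) ρ = ρ v
  eval 𝒜 (op o ts) ρ = Algebra.⟦_⟧ 𝒜 o (λ k → eval 𝒜 (ts k) ρ)

  -- Atomic formula φ(x̄, ȳ) with x̄ = x₁..xₙ, ȳ = y₁..yₘ : an equation t₁ = t₂.
  Atomic : ℕ → ℕ → Set
  Atomic n m = Term (Fin n ⊎ Fin m) × Term (Fin n ⊎ Fin m)

  ⊨∀ : ∀ {a ℓ} (𝒜 : Algebra a ℓ) {n m : ℕ} → Atomic n m →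
       (Fin m → Algebra.∣_∣ 𝒜) → Set (a ⊔ ℓ)
  ⊨∀ 𝒜 (t₁ , t₂) as = ∀ (xs : Fin _ → Algebra.∣_∣ 𝒜) →
    Algebra._≈_ 𝒜 (eval 𝒜 t₁ [ xs , as ]) (eval 𝒜 t₂ [ xs , as ])

  record IsHom {a ℓ b ℓ′} (𝒜 : Algebra a ℓ) (ℬ : Algebra b ℓ′)
               (h : Algebra.∣_∣ 𝒜 → Algebra.∣_∣ ℬ) : Set (a ⊔ ℓ ⊔ ℓ′) where
    field
      cong : ∀ {x y} → Algebra._≈_ 𝒜 x y → Algebra._≈_ ℬ (h x) (h y)
      hom  : ∀ (o : Op) (xs : Fin (arity o) → Algebra.∣_∣ 𝒜) →
             Algebra._≈_ ℬ (h (Algebra.⟦_⟧ 𝒜 o xs)) (Algebra.⟦_⟧ ℬ o (λ k → h (xs k)))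

  record IsEmbedding {a ℓ b ℓ′} (𝒜 : Algebra a ℓ) (ℬ : Algebra b ℓ′)
               (h : Algebra.∣_∣ 𝒜 → Algebra.∣_∣ ℬ) : Set (a ⊔ ℓ ⊔ ℓ′) where
    field
      isHom     : IsHom 𝒜 ℬ h
      injective : ∀ {x y} → Algebra._≈_ ℬ (h x) (h y) → Algebra._≈_ 𝒜 x y

  record Is∀Embedding {a ℓ b ℓ′} (𝒜 : Algebra a ℓ) (ℬ : Algebra b ℓ′)
               (h : Algebra.∣_∣ 𝒜 → Algebra.∣_∣ ℬ) : Set (a ⊔ ℓ ⊔ b ⊔ ℓ′) where
    field
      isEmbedding : IsEmbedding 𝒜 ℬ h
      preserves∀  : ∀ {n m : ℕ} (φ : Atomic n m) (as : Fin m → Algebra.∣_∣ 𝒜) →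
                    ⊨∀ 𝒜 φ as → ⊨∀ ℬ φ (λ k → h (as k))

  Π : ∀ {ι b ℓ} (I : Set ι) → (I → Algebra b ℓ) → Algebra (ι ⊔ b) (ι ⊔ ℓ)
  Π I ℬ = record
    { setoid = record
        { Carrier = (i : I) → Algebra.∣_∣ (ℬ i)
        ; _≈_ = λ x y → ∀ i → Algebra._≈_ (ℬ i) (x i) (y i)
        ; isEquivalence = record
            { refl  = λ i → Algebra.refl (ℬ i)
            ; sym   = λ p i → Algebra.sym (ℬ i) (p i)
            ; trans = λ p q i → Algebra.trans (ℬ i) (p i) (q i)
            }
        }
    ; ⟦_⟧ = λ o xs i → Algebra.⟦_⟧ (ℬ i) o (λ k → xs k i)
    ; ⟦⟧-cong = λ o p i → Algebra.⟦⟧-cong (ℬ i) o (λ k → p k i)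
    }

  record IsSubdirect {a ℓ ι b ℓ′} (𝒜 : Algebra a ℓ) (I : Set ι) (ℬ : I → Algebra b ℓ′)
               (f : Algebra.∣_∣ 𝒜 → Algebra.∣_∣ (Π I ℬ)) : Set (a ⊔ ℓ ⊔ ι ⊔ b ⊔ ℓ′) where
    field
      isEmbedding : IsEmbedding 𝒜 (Π I ℬ) f
      surjective  : ∀ (i : I) (y : Algebra.∣_∣ (ℬ i)) →
                    Σ (Algebra.∣_∣ 𝒜) (λ x → Algebra._≈_ (ℬ i) (f x i) y)

{-# OPTIONS --safe #-}
-- The i-th projection of a subdirect embedding f is a surjective homomorphism,
-- and surjective homomorphisms preserve sentences ∀x̄ φ(x̄, ā) with φ atomic:
-- every tuple of the image lifts to a tuple of the domain. Since equations hold
-- in a product exactly when they hold in every factor, f preserves them too.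
module Submission where

open import Defs
open import Level using (Level)
open import Relation.Unary using (Pred)
open import Data.Fin using (Fin)
open import Data.Sum using (_⊎_; inj₁; inj₂; [_,_])
open import Data.Product using (Σ; _,_; proj₁; proj₂)
import Relation.Binary.Reasoning.Setoid as SetoidReasoning

module _ (𝓛 : Signature) where
  open Algebra using (∣_∣)

  eval-cong : ∀ {a ℓ} (𝒜 : Algebra 𝓛 a ℓ) {V : Set} (t : Term 𝓛 V) {ρ σ : V → ∣ 𝒜 ∣} →
              (∀ v → Algebra._≈_ 𝒜 (ρ v) (σ v)) →
              Algebra._≈_ 𝒜 (eval 𝓛 𝒜 t ρ) (eval 𝓛 𝒜 t σ)
  eval-cong 𝒜 (var v)   ρ≈σ = ρ≈σ v
  eval-cong 𝒜 (op o ts) ρ≈σ = Algebra.⟦⟧-cong 𝒜 o (λ k → eval-cong 𝒜 (ts k) ρ≈σ)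

  eval-hom : ∀ {a ℓ b ℓ′} {𝒜 : Algebra 𝓛 a ℓ} {ℬ : Algebra 𝓛 b ℓ′} {h : ∣ 𝒜 ∣ → ∣ ℬ ∣} →
             IsHom 𝓛 𝒜 ℬ h → {V : Set} (t : Term 𝓛 V) (ρ : V → ∣ 𝒜 ∣) →
             Algebra._≈_ ℬ (h (eval 𝓛 𝒜 t ρ)) (eval 𝓛 ℬ t (λ v → h (ρ v)))
  eval-hom {ℬ = ℬ} h-hom (var v)   ρ = Algebra.refl ℬ
  eval-hom {ℬ = ℬ} h-hom (op o ts) ρ =
    Algebra.trans ℬ (IsHom.hom h-hom o _) (Algebra.⟦⟧-cong ℬ o (λ k → eval-hom h-hom (ts k) ρ))

  proj-isHom : ∀ {ι b ℓ} {I : Set ι} (ℬ : I → Algebra 𝓛 b ℓ) (i : I) →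
               IsHom 𝓛 (Π 𝓛 I ℬ) (ℬ i) (λ x → x i)
  proj-isHom ℬ i = record
    { cong = λ x≈y → x≈y i
    ; hom  = λ o xs → Algebra.refl (ℬ i)
    }

  ∘-isHom : ∀ {a ℓ b ℓ′ c ℓ″} {𝒜 : Algebra 𝓛 a ℓ} {ℬ : Algebra 𝓛 b ℓ′} {𝒞 : Algebra 𝓛 c ℓ″}
            {g : ∣ ℬ ∣ → ∣ 𝒞 ∣} {h : ∣ 𝒜 ∣ → ∣ ℬ ∣} →
            IsHom 𝓛 ℬ 𝒞 g → IsHom 𝓛 𝒜 ℬ h → IsHom 𝓛 𝒜 𝒞 (λ x → g (h x))
  ∘-isHom {𝒞 = 𝒞} {h = h} g-hom h-hom = record
    { cong = λ x≈y → IsHom.cong g-hom (IsHom.cong h-hom x≈y)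
    ; hom  = λ o xs → Algebra.trans 𝒞 (IsHom.cong g-hom (IsHom.hom h-hom o xs))
                                       (IsHom.hom g-hom o (λ k → h (xs k)))
    }

  ⊨∀-surjective-hom : ∀ {a ℓ b ℓ′} {𝒜 : Algebra 𝓛 a ℓ} {ℬ : Algebra 𝓛 b ℓ′} {h : ∣ 𝒜 ∣ → ∣ ℬ ∣} →
                      IsHom 𝓛 𝒜 ℬ h → (∀ y → Σ ∣ 𝒜 ∣ (λ x → Algebra._≈_ ℬ (h x) y)) →
                      ∀ {n m} (φ : Atomic 𝓛 n m) (as : Fin m → ∣ 𝒜 ∣) →
                      ⊨∀ 𝓛 𝒜 φ as → ⊨∀ 𝓛 ℬ φ (λ k → h (as k))
  ⊨∀-surjective-hom {𝒜 = 𝒜} {ℬ} {h} h-hom h-surj {n} {m} (t₁ , t₂) as 𝒜⊨φ ys = begin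
    eval 𝓛 ℬ t₁ [ ys , h∘as ]        ≈⟨ eval-lift t₁ ⟩
    h (eval 𝓛 𝒜 t₁ [ xs , as ])      ≈⟨ IsHom.cong h-hom (𝒜⊨φ xs) ⟩
    h (eval 𝓛 𝒜 t₂ [ xs , as ])      ≈⟨ eval-lift t₂ ⟨
    eval 𝓛 ℬ t₂ [ ys , h∘as ]        ∎
    where
    open SetoidReasoning (Algebra.setoid ℬ)
    h∘as : Fin m → ∣ ℬ ∣
    h∘as k = h (as k)
    xs : Fin n → ∣ 𝒜 ∣
    xs k = proj₁ (h-surj (ys k))
    h-lifts : ∀ v → Algebra._≈_ ℬ (h ([ xs , as ] v)) ([ ys , h∘as ] v)
    h-lifts (inj₁ k) = proj₂ (h-surj (ys k))
    h-lifts (inj₂ k) = Algebra.refl ℬ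
    eval-lift : ∀ t → Algebra._≈_ ℬ (eval 𝓛 ℬ t [ ys , h∘as ]) (h (eval 𝓛 𝒜 t [ xs , as ]))
    eval-lift t = Algebra.sym ℬ
      (Algebra.trans ℬ (eval-hom h-hom t [ xs , as ]) (eval-cong ℬ t h-lifts))

  ⊨∀-Π : ∀ {ι b ℓ} {I : Set ι} (ℬ : I → Algebra 𝓛 b ℓ) {n m} (φ : Atomic 𝓛 n m)
         (as : Fin m → ∣ Π 𝓛 I ℬ ∣) →
         (∀ i → ⊨∀ 𝓛 (ℬ i) φ (λ k → as k i)) → ⊨∀ 𝓛 (Π 𝓛 I ℬ) φ as
  ⊨∀-Π ℬ {n} {m} (t₁ , t₂) as ℬ⊨φ ys i = begin
    eval 𝓛 (Π 𝓛 _ ℬ) t₁ ρ i                ≈⟨ eval-hom (proj-isHom ℬ i) t₁ ρ ⟩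
    eval 𝓛 (ℬ i) t₁ (λ v → ρ v i)          ≈⟨ eval-cong (ℬ i) t₁ ρ-at-i ⟩
    eval 𝓛 (ℬ i) t₁ [ ys-at-i , as-at-i ]  ≈⟨ ℬ⊨φ i ys-at-i ⟩
    eval 𝓛 (ℬ i) t₂ [ ys-at-i , as-at-i ]  ≈⟨ eval-cong (ℬ i) t₂ ρ-at-i ⟨
    eval 𝓛 (ℬ i) t₂ (λ v → ρ v i)          ≈⟨ eval-hom (proj-isHom ℬ i) t₂ ρ ⟨
    eval 𝓛 (Π 𝓛 _ ℬ) t₂ ρ i                ∎
    where
    open SetoidReasoning (Algebra.setoid (ℬ i))
    ρ : Fin n ⊎ Fin m → ∣ Π 𝓛 _ ℬ ∣
    ρ = [ ys , as ]
    ys-at-i : Fin n → ∣ ℬ i ∣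
    ys-at-i k = ys k i
    as-at-i : Fin m → ∣ ℬ i ∣
    as-at-i k = as k i
    ρ-at-i : ∀ v → Algebra._≈_ (ℬ i) (ρ v i) ([ ys-at-i , as-at-i ] v)
    ρ-at-i (inj₁ k) = Algebra.refl (ℬ i)
    ρ-at-i (inj₂ k) = Algebra.refl (ℬ i)

proposition3p5 : ∀ {k a ℓ ι b ℓ′ : Level} (𝓛 : Signature) (K : Pred (Algebra 𝓛 b ℓ′) k)
    (𝒜 : Algebra 𝓛 a ℓ) (I : Set ι) (ℬ : I → Algebra 𝓛 b ℓ′) → (∀ i → K (ℬ i)) →
    (f : Algebra.∣_∣ 𝒜 → Algebra.∣_∣ (Π 𝓛 I ℬ)) →
    IsSubdirect 𝓛 𝒜 I ℬ f → Is∀Embedding 𝓛 𝒜 (Π 𝓛 I ℬ) f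
proposition3p5 𝓛 _ 𝒜 I ℬ _ f f-subdirect = record
  { isEmbedding = f-embedding
  ; preserves∀  = λ φ as 𝒜⊨φ → ⊨∀-Π 𝓛 ℬ φ (λ k → f (as k)) (λ i →
      ⊨∀-surjective-hom 𝓛 (∘-isHom 𝓛 (proj-isHom 𝓛 ℬ i) (IsEmbedding.isHom f-embedding))
                          (IsSubdirect.surjective f-subdirect i) φ as 𝒜⊨φ)
  }
  where
  f-embedding : IsEmbedding 𝓛 𝒜 (Π 𝓛 I ℬ) f
  f-embedding = IsSubdirect.isEmbedding f-subdirect
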